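{- Let $f(a,b,c)\in\mathbb{Z}[a,b,c]$ be any polynomial with integer coefficients. A triple $(a,b,c)$ of pairwise coprime positive integers satisfies $$a^{2}+b^{2}+c^{2}=abc\,f(a,b,c)$$ if and only if $(a,b,c)$ is a Markov triple (i.e. $a^{2}+b^{2}+c^{2}=3abc$) and $f(a,b,c)=3$.
   Context: A Markov triple is a triple $(a,b,c)$ of positive integers satisfying $a^{2}+b^{2}+c^{2}=3abc$. -}

module Defs where

open import Data.Nat as ℕ using (ℕ)
open import Data.Integer as ℤ using (ℤ)

-- Polynomials in three variables a, b, c with integer coefficients,
-- represented syntactically (every element of ℤ[a,b,c] is denoted by
-- some term, and evaluation is the usual ring evaluation).
data Poly3 : Set where
  con  : ℤ → Poly3
  varA : Poly3
  varB : Poly3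
  varC : Poly3
  _⊕_  : Poly3 → Poly3 → Poly3
  _⊗_  : Poly3 → Poly3 → Poly3

eval : Poly3 → ℤ → ℤ → ℤ → ℤ
eval (con k) a b c = k
eval varA    a b c = a
eval varB    a b c = b
eval varC    a b c = c
eval (p ⊕ q) a b c = eval p a b c ℤ.+ eval q a b c
eval (p ⊗ q) a b c = eval p a b c ℤ.* eval q a b c

-- Markov triple: a² + b² + c² = 3abc (positivity is imposed separately).
IsMarkovTriple : ℕ → ℕ → ℕ → Set
IsMarkovTriple a b c = a ℕ.* a ℕ.+ b ℕ.* b ℕ.+ c ℕ.* c ≡ 3 ℕ.* a ℕ.* b ℕ.* c
  where open import Relation.Binary.PropositionalEquality using (_≡_)

{-# OPTIONS --safe #-}
-- Write k for the value of f at (a, b, c), so that a² + b² + c² = k·a·b·c.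
-- Positivity forces k to be a positive integer, and only k = 3 survives:
-- for k = 1 the equation modulo 3 makes 3 divide both a and b, for k = 2
-- the equation modulo 4 makes 2 divide both a and b, and for k ≥ 4 there
-- are no positive solutions at all, by Vieta jumping: replacing the largest
-- coordinate z by the other root xyk − z of the quadratic in z yields a
-- positive solution with a strictly smaller sum.
module Submission where

open import Defs
open import Data.Nat as ℕ using (ℕ; _≥_)
open import Data.Nat.Coprimality using (Coprime)
open import Data.Integer as ℤ using (ℤ; +_)
open import Data.Product using (_×_)
open import Function.Bundles using (_⇔_)
open import Relation.Binary.PropositionalEquality using (_≡_)

open import Data.Nat using (suc; _+_; _*_; _∸_; _≤_; _<_; s≤s; z≤n; NonZero)
open import Data.Nat.Properties
open import Data.Nat.DivMod using (_%_; _mod_; m%n<n; m%n%n≡m%n; %-distribˡ-+; %-distribˡ-*)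
open import Data.Nat.Divisibility using (_∣_; _∣?_; divides-refl; ∣n∣m%n⇒∣m)
open import Data.Nat.Induction using (<-wellFounded)
open import Data.Nat.Tactic.RingSolver using (solve-∀)
open import Data.Fin using (Fin; toℕ)
open import Data.Fin.Properties using (all?; toℕ-fromℕ<)
open import Data.Integer.Properties using (pos-*; +-injective)
open import Data.Product using (∃-syntax; _,_)
open import Data.Sum using (_⊎_; inj₁; inj₂; [_,_]′)
open import Data.Empty using (⊥; ⊥-elim)
open import Function.Bundles using (mk⇔; Equivalence)
open import Function.Base using (case_of_)
open import Induction.WellFounded using (Acc; acc)
open import Relation.Nullary using (¬_; contradiction; yes; no)
open import Relation.Nullary.Decidable using (Dec; toWitness; _→-dec_; _×-dec_)
open import Relation.Binary.PropositionalEquality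
  using (_≢_; refl; sym; trans; cong; cong₂; subst; module ≡-Reasoning)

MarkovEq : ℕ → ℕ → ℕ → ℕ → Set
MarkovEq k x y z = x * x + y * y + z * z ≡ x * y * z * k

MarkovEq-swap₂₃ : ∀ {k} x y z → MarkovEq k x y z → MarkovEq k x z y
MarkovEq-swap₂₃ {k} x y z e = trans (lhs x y z) (trans e (rhs x y z k))
  where
  lhs : ∀ x y z → x * x + z * z + y * y ≡ x * x + y * y + z * z
  lhs = solve-∀
  rhs : ∀ x y z k → x * y * z * k ≡ x * z * y * k
  rhs = solve-∀

MarkovEq-swap₁₃ : ∀ {k} x y z → MarkovEq k x y z → MarkovEq k z y x
MarkovEq-swap₁₃ {k} x y z e = trans (lhs x y z) (trans e (rhs x y z k))
  where
  lhs : ∀ x y z → z * z + y * y + x * x ≡ x * x + y * y + z * z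
  lhs = solve-∀
  rhs : ∀ x y z k → x * y * z * k ≡ z * y * x * k
  rhs = solve-∀

MarkovEq⇒quadratic : ∀ {k} x y z → MarkovEq k x y z → z * z + (x * x + y * y) ≡ x * y * k * z
MarkovEq⇒quadratic {k} x y z e = trans (lhs x y z) (trans e (rhs x y z k))
  where
  lhs : ∀ x y z → z * z + (x * x + y * y) ≡ x * x + y * y + z * z
  lhs = solve-∀
  rhs : ∀ x y z k → x * y * z * k ≡ x * y * k * z
  rhs = solve-∀

quadratic⇒MarkovEq : ∀ {k} x y z → z * z + (x * x + y * y) ≡ x * y * k * z → MarkovEq k x y z
quadratic⇒MarkovEq {k} x y z e = trans (lhs x y z) (trans e (rhs x y z k))
  where
  lhs : ∀ x y z → x * x + y * y + z * z ≡ z * z + (x * x + y * y)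
  lhs = solve-∀
  rhs : ∀ x y z k → x * y * k * z ≡ x * y * z * k
  rhs = solve-∀

vieta-partner : ∀ {s p z} → 1 ≤ p → z * z + p ≡ s * z → ∃[ z' ] (1 ≤ z' × z + z' ≡ s × z * z' ≡ p)
vieta-partner {s} {p} {z} 1≤p e = s ∸ z , n≢0⇒n>0 z'≢0 , z+z'≡s , z*z'≡p
  where
  open ≡-Reasoning
  z*z'≡p : z * (s ∸ z) ≡ p
  z*z'≡p = begin
    z * (s ∸ z)           ≡⟨ *-distribˡ-∸ z s z ⟩
    z * s ∸ z * z         ≡⟨ cong (_∸ z * z) (trans (*-comm z s) (sym e)) ⟩
    z * z + p ∸ z * z     ≡⟨ m+n∸m≡n (z * z) p ⟩
    p                     ∎
  z'≢0 : s ∸ z ≢ 0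
  z'≢0 z'≡0 = contradiction (trans (sym z*z'≡p) (trans (cong (z *_) z'≡0) (*-zeroʳ z))) (m<n⇒n≢0 1≤p)
  z+z'≡s : z + (s ∸ z) ≡ s
  z+z'≡s = m+[n∸m]≡n (<⇒≤ (m∸n≢0⇒n<m {s} {z} z'≢0))

vieta-partner-root : ∀ {s p z z'} → z + z' ≡ s → z * z' ≡ p → z' * z' + p ≡ s * z'
vieta-partner-root {z = z} {z'} refl refl = identity z z'
  where
  identity : ∀ z z' → z' * z' + z * z' ≡ (z + z') * z'
  identity = solve-∀

m*[n+o]≤n*o+m*m : ∀ {m n o} → m ≤ n → m ≤ o → m * (n + o) ≤ n * o + m * m
m*[n+o]≤n*o+m*m {m} m≤n m≤o with m≤n⇒∃[o]m+o≡n m≤n | m≤n⇒∃[o]m+o≡n m≤o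
... | p , refl | q , refl = subst (m * (m + p + (m + q)) ≤_) (expand m p q) (m≤m+n _ (p * q))
  where
  expand : ∀ m p q → m * (m + p + (m + q)) + p * q ≡ (m + p) * (m + q) + m * m
  expand = solve-∀

module _ {k : ℕ} (4≤k : 4 ≤ k) where

  -- With x ≤ y ≤ z the quadratic t² − xyk·t + x² + y² is negative at t = y,
  -- so y lies strictly between its two roots.
  partner<middle : ∀ {x y z z'} → 1 ≤ x → x ≤ y → y ≤ z →
                   z + z' ≡ x * y * k → z * z' ≡ x * x + y * y → z' < y
  partner<middle {x} {y} {z} {z'} 1≤x x≤y y≤z z+z'≡s z*z'≡p with z' <? y
  ... | yes z'<y = z'<y
  ... | no  z'≮y = contradiction impossible (<-irrefl refl)
    where
    open ≤-Reasoning
    Y = y * y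
    1≤Y : 1 ≤ Y
    1≤Y = *-mono-≤ (≤-trans 1≤x x≤y) (≤-trans 1≤x x≤y)
    rearrange : ∀ x y k → y * (x * y * k) ≡ x * k * (y * y)
    rearrange = solve-∀
    triple : ∀ Y → Y + Y + Y ≡ 3 * Y
    triple = solve-∀
    impossible : 3 * Y < 3 * Y
    impossible = begin-strict
      3 * Y                   <⟨ m<n+m (3 * Y) 1≤Y ⟩
      4 * Y                   ≤⟨ *-monoˡ-≤ Y (*-mono-≤ 1≤x 4≤k) ⟩
      x * k * Y               ≡⟨ rearrange x y k ⟨
      y * (x * y * k)         ≡⟨ cong (y *_) z+z'≡s ⟨
      y * (z + z')            ≤⟨ m*[n+o]≤n*o+m*m y≤z (≮⇒≥ z'≮y) ⟩
      z * z' + Y              ≡⟨ cong (_+ Y) z*z'≡p ⟩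
      x * x + Y + Y           ≤⟨ +-monoˡ-≤ Y (+-monoˡ-≤ Y (*-mono-≤ x≤y x≤y)) ⟩
      Y + Y + Y               ≡⟨ triple Y ⟩
      3 * Y                   ∎

  descend-largest : ∀ {x y z} → 1 ≤ x → 1 ≤ y → x ≤ z → y ≤ z → MarkovEq k x y z →
                    ∃[ z' ] (1 ≤ z' × z' < z × MarkovEq k x y z')
  descend-largest {x} {y} {z} 1≤x 1≤y x≤z y≤z e
    with vieta-partner (≤-trans (*-mono-≤ 1≤x 1≤x) (m≤m+n (x * x) (y * y))) (MarkovEq⇒quadratic x y z e)
  ... | z' , 1≤z' , z+z'≡s , z*z'≡p =
    z' , 1≤z' , z'<z , quadratic⇒MarkovEq x y z' (vieta-partner-root z+z'≡s z*z'≡p)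
    where
    z'<z : z' < z
    z'<z with ≤-total x y
    ... | inj₁ x≤y = <-≤-trans (partner<middle 1≤x x≤y y≤z z+z'≡s z*z'≡p) y≤z
    ... | inj₂ y≤x = <-≤-trans (partner<middle 1≤y y≤x x≤z
                                  (trans z+z'≡s (cong (_* k) (*-comm x y)))
                                  (trans z*z'≡p (+-comm (x * x) (y * y)))) x≤z

  ¬MarkovEq-k≥4 : ∀ {x y z} → 1 ≤ x → 1 ≤ y → 1 ≤ z → ¬ MarkovEq k x y z
  ¬MarkovEq-k≥4 = descent (<-wellFounded _)
    where
    descent : ∀ {x y z} → Acc _<_ (x + y + z) → 1 ≤ x → 1 ≤ y → 1 ≤ z → ¬ MarkovEq k x y z
    descent {x} {y} {z} (acc rs) 1≤x 1≤y 1≤z e = by-largest (≤-total x y)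
      where
      jump-z : x ≤ z → y ≤ z → ⊥
      jump-z x≤z y≤z with descend-largest 1≤x 1≤y x≤z y≤z e
      ... | z' , 1≤z' , z'<z , e' = descent (rs (+-monoʳ-< (x + y) z'<z)) 1≤x 1≤y 1≤z' e'
      jump-y : x ≤ y → z ≤ y → ⊥
      jump-y x≤y z≤y with descend-largest 1≤x 1≤z x≤y z≤y (MarkovEq-swap₂₃ x y z e)
      ... | y' , 1≤y' , y'<y , e' =
        descent (rs (+-monoˡ-< z (+-monoʳ-< x y'<y))) 1≤x 1≤y' 1≤z (MarkovEq-swap₂₃ x z y' e')
      jump-x : z ≤ x → y ≤ x → ⊥
      jump-x z≤x y≤x with descend-largest 1≤z 1≤y z≤x y≤x (MarkovEq-swap₁₃ x y z e)
      ... | x' , 1≤x' , x'<x , e' =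
        descent (rs (+-monoˡ-< z (+-monoˡ-< y x'<x))) 1≤x' 1≤y 1≤z (MarkovEq-swap₁₃ z y x' e')
      by-largest : x ≤ y ⊎ y ≤ x → ⊥
      by-largest (inj₁ x≤y) = [ (λ y≤z → jump-z (≤-trans x≤y y≤z) y≤z) , jump-y x≤y ]′ (≤-total y z)
      by-largest (inj₂ y≤x) = [ (λ x≤z → jump-z x≤z (≤-trans y≤x x≤z)) , (λ z≤x → jump-x z≤x y≤x) ]′ (≤-total x z)

%-cong-+ : ∀ {x x' y y'} n .{{_ : NonZero n}} →
           x % n ≡ x' % n → y % n ≡ y' % n → (x + y) % n ≡ (x' + y') % n
%-cong-+ {x} {x'} {y} {y'} n x≡x' y≡y' = begin
  (x + y) % n               ≡⟨ %-distribˡ-+ x y n ⟩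
  (x % n + y % n) % n       ≡⟨ cong₂ (λ u v → (u + v) % n) x≡x' y≡y' ⟩
  (x' % n + y' % n) % n     ≡⟨ %-distribˡ-+ x' y' n ⟨
  (x' + y') % n             ∎
  where open ≡-Reasoning

%-cong-* : ∀ {x x' y y'} n .{{_ : NonZero n}} →
           x % n ≡ x' % n → y % n ≡ y' % n → (x * y) % n ≡ (x' * y') % n
%-cong-* {x} {x'} {y} {y'} n x≡x' y≡y' = begin
  (x * y) % n               ≡⟨ %-distribˡ-* x y n ⟩
  (x % n * (y % n)) % n     ≡⟨ cong₂ (λ u v → (u * v) % n) x≡x' y≡y' ⟩
  (x' % n * (y' % n)) % n   ≡⟨ %-distribˡ-* x' y' n ⟨
  (x' * y') % n             ∎
  where open ≡-Reasoning

MarkovEqMod : (n : ℕ) .{{_ : NonZero n}} → ℕ → ℕ → ℕ → ℕ → Set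
MarkovEqMod n k x y z = (x * x + y * y + z * z) % n ≡ (x * y * z * k) % n

toℕ-mod : ∀ x n .{{_ : NonZero n}} → toℕ (x mod n) ≡ x % n
toℕ-mod x n = toℕ-fromℕ< (m%n<n x n)

MarkovEq⇒MarkovEqMod : ∀ {k x y z} n .{{_ : NonZero n}} → MarkovEq k x y z →
                       MarkovEqMod n k (toℕ (x mod n)) (toℕ (y mod n)) (toℕ (z mod n))
MarkovEq⇒MarkovEqMod {k} {x} {y} {z} n e = begin
  (x′ * x′ + y′ * y′ + z′ * z′) % n   ≡⟨ sum-of-squares ⟨
  (x * x + y * y + z * z) % n         ≡⟨ cong (_% n) e ⟩
  (x * y * z * k) % n                 ≡⟨ product ⟩
  (x′ * y′ * z′ * k) % n              ∎
  where
  open ≡-Reasoning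
  x′ = toℕ (x mod n)
  y′ = toℕ (y mod n)
  z′ = toℕ (z mod n)
  reduce : ∀ w → w % n ≡ toℕ (w mod n) % n
  reduce w = trans (sym (m%n%n≡m%n w n)) (cong (_% n) (sym (toℕ-mod w n)))
  square : ∀ w → (w * w) % n ≡ (toℕ (w mod n) * toℕ (w mod n)) % n
  square w = %-cong-* n (reduce w) (reduce w)
  sum-of-squares : (x * x + y * y + z * z) % n ≡ (x′ * x′ + y′ * y′ + z′ * z′) % n
  sum-of-squares = %-cong-+ n (%-cong-+ n (square x) (square y)) (square z)
  product : (x * y * z * k) % n ≡ (x′ * y′ * z′ * k) % n
  product = %-cong-* n (%-cong-* n (%-cong-* n (reduce x) (reduce y)) (reduce z)) refl

ResiduesDivisible : (n : ℕ) .{{_ : NonZero n}} → ℕ → ℕ → Set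
ResiduesDivisible n k d =
  ∀ (r s t : Fin n) → MarkovEqMod n k (toℕ r) (toℕ s) (toℕ t) → d ∣ toℕ r × d ∣ toℕ s

residuesDivisible? : ∀ n .{{_ : NonZero n}} k d → Dec (ResiduesDivisible n k d)
residuesDivisible? n k d =
  all? λ r → all? λ s → all? λ t → (_ ≟ _) →-dec (d ∣? toℕ r ×-dec d ∣? toℕ s)

MarkovEq⇒common-divisor : ∀ {k x y z} n .{{_ : NonZero n}} {d} → d ∣ n →
                          ResiduesDivisible n k d → MarkovEq k x y z → d ∣ x × d ∣ y
MarkovEq⇒common-divisor {k} {x} {y} {z} n d∣n residues e
  with residues (x mod n) (y mod n) (z mod n) (MarkovEq⇒MarkovEqMod n e)
... | d∣x′ , d∣y′ = ∣n∣m%n⇒∣m d∣n (subst (_ ∣_) (toℕ-mod x n) d∣x′)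
                  , ∣n∣m%n⇒∣m d∣n (subst (_ ∣_) (toℕ-mod y n) d∣y′)

residues-mod-3 : ResiduesDivisible 3 1 3
residues-mod-3 = toWitness {a? = residuesDivisible? 3 1 3} _

residues-mod-4 : ResiduesDivisible 4 2 2
residues-mod-4 = toWitness {a? = residuesDivisible? 4 2 2} _

MarkovEq-k≢1 : ∀ {x y z} → Coprime x y → ¬ MarkovEq 1 x y z
MarkovEq-k≢1 x⊥y e = case x⊥y (MarkovEq⇒common-divisor 3 (divides-refl 1) residues-mod-3 e) of λ ()

MarkovEq-k≢2 : ∀ {x y z} → Coprime x y → ¬ MarkovEq 2 x y z
MarkovEq-k≢2 x⊥y e = case x⊥y (MarkovEq⇒common-divisor 4 (divides-refl 2) residues-mod-4 e) of λ ()

MarkovEq⇒k≡3 : ∀ {k x y z} → 1 ≤ x → 1 ≤ y → 1 ≤ z → Coprime x y → MarkovEq k x y z → k ≡ 3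
-- Matching 1 ≤ x on s≤s makes the left-hand side a successor.
MarkovEq⇒k≡3 {0} {x} {y} {z} (s≤s _) _ _ _ e = case trans e (*-zeroʳ (x * y * z)) of λ ()
MarkovEq⇒k≡3 {1} _ _ _ x⊥y e = ⊥-elim (MarkovEq-k≢1 x⊥y e)
MarkovEq⇒k≡3 {2} _ _ _ x⊥y e = ⊥-elim (MarkovEq-k≢2 x⊥y e)
MarkovEq⇒k≡3 {3} _ _ _ _ _ = refl
MarkovEq⇒k≡3 {suc (suc (suc (suc _)))} 1≤x 1≤y 1≤z _ e =
  ⊥-elim (¬MarkovEq-k≥4 (s≤s (s≤s (s≤s (s≤s z≤n)))) 1≤x 1≤y 1≤z e)

IsMarkovTriple⇔MarkovEq-3 : ∀ x y z → IsMarkovTriple x y z ⇔ MarkovEq 3 x y z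
IsMarkovTriple⇔MarkovEq-3 x y z = mk⇔ (λ e → trans e (comm x y z)) (λ e → trans e (sym (comm x y z)))
  where
  comm : ∀ x y z → 3 * x * y * z ≡ x * y * z * 3
  comm = solve-∀

+≡+*⇒natural : ∀ {l m} (e : ℤ) → 1 ≤ m → + l ≡ + m ℤ.* e → ∃[ k ] (e ≡ + k × l ≡ m * k)
+≡+*⇒natural {m = m} (+ k) _ eq = k , refl , +-injective (trans eq (sym (pos-* m k)))
+≡+*⇒natural {m = suc _} ℤ.-[1+ _ ] _ ()

theorem2 : (f : Poly3) (a b c : ℕ) → a ≥ 1 → b ≥ 1 → c ≥ 1 →
    Coprime a b → Coprime b c → Coprime a c →
    ((+ (a ℕ.* a ℕ.+ b ℕ.* b ℕ.+ c ℕ.* c))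
        ≡ (+ (a ℕ.* b ℕ.* c)) ℤ.* eval f (+ a) (+ b) (+ c))
    ⇔ (IsMarkovTriple a b c × eval f (+ a) (+ b) (+ c) ≡ + 3)
theorem2 f a b c 1≤a 1≤b 1≤c a⊥b _ _ = mk⇔ to from
  where
  k = eval f (+ a) (+ b) (+ c)
  to : + (a * a + b * b + c * c) ≡ + (a * b * c) ℤ.* k → IsMarkovTriple a b c × k ≡ + 3
  to eq with +≡+*⇒natural k (*-mono-≤ (*-mono-≤ 1≤a 1≤b) 1≤c) eq
  ... | k′ , k≡k′ , e with MarkovEq⇒k≡3 1≤a 1≤b 1≤c a⊥b e
  ... | refl = Equivalence.from (IsMarkovTriple⇔MarkovEq-3 a b c) e , k≡k′
  from : IsMarkovTriple a b c × k ≡ + 3 → + (a * a + b * b + c * c) ≡ + (a * b * c) ℤ.* k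
  from (markov , k≡3) = begin
    + (a * a + b * b + c * c)   ≡⟨ cong +_ (Equivalence.to (IsMarkovTriple⇔MarkovEq-3 a b c) markov) ⟩
    + (a * b * c * 3)           ≡⟨ pos-* (a * b * c) 3 ⟩
    + (a * b * c) ℤ.* + 3       ≡⟨ cong (+ (a * b * c) ℤ.*_) k≡3 ⟨
    + (a * b * c) ℤ.* k         ∎
    where open ≡-Reasoning
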